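{- (i) If $\mathbf P=(P,\le,0,1)$ is a bounded poset satisfying the ACC and the DCC, then $\mathbb P(\mathbb A(\mathbf P))=\mathbf P$. (ii) If $\mathbf A=(P,\sqcup,\sqcap,0,1)$ is a finite operator structure and $\mathbb A(\mathbb P(\mathbf A))=(P,\sqcup_1,\sqcap_1,0,1)$, then $x\sqcup_1y=x\sqcup y$ and $x\sqcap_1y=x\sqcap y$ for all $x,y\in P$.
   Context: ACC/DCC: no infinite strictly ascending/descending chains. In a poset, $L(A)$, $U(A)$ denote the sets of lower/upper bounds of $A$, $\operatorname{Max}$, $\operatorname{Min}$ the sets of maximal/minimal elements, $\operatorname{Max}L(x,y)=\operatorname{Max}(L(\{x,y\}))$, $\operatorname{Min}U(x,y)=\operatorname{Min}(U(\{x,y\}))$, and for subsets $\operatorname{Min}U(A,B)=\operatorname{Min}U(A\cup B)$, $\operatorname{Max}L(A,B)=\operatorname{Max}L(A\cup B)$. A binary operator on $P$ assigns to each pair of elements (and pair of subsets) a subset of $P$; elements are identified with singletons. An operator structure is $(P,\sqcup,\sqcap,0,1)$ with binary operators $\sqcup,\sqcap$ and $0,1\in P$ such that for all $x,y,z\in P$: (i) $x\sqcup x=x$, $x\sqcap x=x$; (ii) $x\sqcup y=y\sqcup x$, $x\sqcap y=y\sqcap x$; (iii) $0\sqcup x=x$, $x\sqcap1=x$; (iv) $x\sqcup((x\sqcup y)\sqcup z)=0\sqcup((x\sqcup y)\sqcup z)$ and $x\sqcap((x\sqcap y)\sqcap z)=((x\sqcap y)\sqcap z)\sqcap1$; (v)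 $(x\sqcap y)\sqcup y=y$, $x\sqcap(x\sqcup y)=x$; (vi) $z\in x\sqcup y$ iff [$x\sqcup z=y\sqcup z=z$ and every $u\in P$ with $x\sqcup u=y\sqcup u=u\sqcap z=u$ satisfies $u=z$], and $z\in x\sqcap y$ iff [$z\sqcap x=z\sqcap y=z$ and every $u\in P$ with $u\sqcap x=u\sqcap y=z\sqcup u=u$ satisfies $u=z$]. For a bounded poset $\mathbf P=(P,\le,0,1)$ with ACC and DCC, $\mathbb A(\mathbf P):=(P,\operatorname{Min}U,\operatorname{Max}L,0,1)$ (an operator structure). For an operator structure $\mathbf A=(P,\sqcup,\sqcap,0,1)$, $\mathbb P(\mathbf A):=(P,\le,0,1)$ where $x\le y$ iff $x\sqcup y=y$ (a bounded poset). -}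

module Defs where

open import Level using (0ℓ)
open import Data.Nat using (ℕ; suc)
open import Data.Fin using (Fin)
open import Data.Product using (Σ; _×_)
open import Relation.Nullary using (¬_)
open import Relation.Binary.PropositionalEquality using (_≡_; _≢_)
open import Relation.Binary.Structures using (IsPartialOrder)
open import Relation.Unary using (Pred; _∈_; _≐_; ｛_｝; _∪_)
open import Function.Bundles using (_⇔_; _↔_)

-- Subsets of P (elements are identified with the singletons ｛ x ｝).
Subset : Set → Set₁
Subset P = Pred P 0ℓ

Op : Set → Set₁
Op P = Subset P → Subset P → Subset P

_⟨_⟩_ : {P : Set} → P → Op P → P → Subset P
x ⟨ op ⟩ y = op ｛ x ｝ ｛ y ｝

-- Operator structure (P, ⊔, ⊓, 0, 1), axioms (i)-(vi).
-- Subsets are predicates, so equality of subsets is extensional (≐);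
-- the cong fields express that ⊔, ⊓ are genuine functions of subsets.
record IsOperatorStructure {P : Set} (⊔ ⊓ : Op P) (𝟘 𝟙 : P) : Set₁ where
  field
    ⊔-cong : ∀ {A A′ B B′ : Subset P} → A ≐ A′ → B ≐ B′ → ⊔ A B ≐ ⊔ A′ B′
    ⊓-cong : ∀ {A A′ B B′ : Subset P} → A ≐ A′ → B ≐ B′ → ⊓ A B ≐ ⊓ A′ B′
    ⊔-idem : ∀ x → x ⟨ ⊔ ⟩ x ≐ ｛ x ｝
    ⊓-idem : ∀ x → x ⟨ ⊓ ⟩ x ≐ ｛ x ｝
    ⊔-comm : ∀ x y → x ⟨ ⊔ ⟩ y ≐ y ⟨ ⊔ ⟩ x
    ⊓-comm : ∀ x y → x ⟨ ⊓ ⟩ y ≐ y ⟨ ⊓ ⟩ x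
    ⊔-identity : ∀ x → 𝟘 ⟨ ⊔ ⟩ x ≐ ｛ x ｝
    ⊓-identity : ∀ x → x ⟨ ⊓ ⟩ 𝟙 ≐ ｛ x ｝
    ⊔-iv : ∀ x y z → ⊔ ｛ x ｝ (⊔ (x ⟨ ⊔ ⟩ y) ｛ z ｝) ≐ ⊔ ｛ 𝟘 ｝ (⊔ (x ⟨ ⊔ ⟩ y) ｛ z ｝)
    ⊓-iv : ∀ x y z → ⊓ ｛ x ｝ (⊓ (x ⟨ ⊓ ⟩ y) ｛ z ｝) ≐ ⊓ (⊓ (x ⟨ ⊓ ⟩ y) ｛ z ｝) ｛ 𝟙 ｝
    ⊔-absorb : ∀ x y → ⊔ (x ⟨ ⊓ ⟩ y) ｛ y ｝ ≐ ｛ y ｝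
    ⊓-absorb : ∀ x y → ⊓ ｛ x ｝ (x ⟨ ⊔ ⟩ y) ≐ ｛ x ｝
    ⊔-vi : ∀ x y z →
      z ∈ x ⟨ ⊔ ⟩ y ⇔
      ((x ⟨ ⊔ ⟩ z ≐ ｛ z ｝) × (y ⟨ ⊔ ⟩ z ≐ ｛ z ｝) ×
       (∀ u → x ⟨ ⊔ ⟩ u ≐ ｛ u ｝ → y ⟨ ⊔ ⟩ u ≐ ｛ u ｝ → u ⟨ ⊓ ⟩ z ≐ ｛ u ｝ → u ≡ z))
    ⊓-vi : ∀ x y z →
      z ∈ x ⟨ ⊓ ⟩ y ⇔
      ((z ⟨ ⊓ ⟩ x ≐ ｛ z ｝) × (z ⟨ ⊓ ⟩ y ≐ ｛ z ｝) ×
       (∀ u → u ⟨ ⊓ ⟩ x ≐ ｛ u ｝ → u ⟨ ⊓ ⟩ y ≐ ｛ u ｝ → z ⟨ ⊔ ⟩ u ≐ ｛ u ｝ → u ≡ z))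

Finite : Set → Set
Finite P = Σ ℕ λ n → Fin n ↔ P

module _ {P : Set} (_≤_ : P → P → Set) where

  IsBoundedPoset : P → P → Set
  IsBoundedPoset 𝟘 𝟙 = IsPartialOrder _≡_ _≤_ × (∀ x → 𝟘 ≤ x) × (∀ x → x ≤ 𝟙)

  _<_ : P → P → Set
  x < y = (x ≤ y) × (x ≢ y)

  ACC : Set
  ACC = ¬ (Σ (ℕ → P) λ f → ∀ n → f n < f (suc n))

  DCC : Set
  DCC = ¬ (Σ (ℕ → P) λ f → ∀ n → f (suc n) < f n)

  U : Subset P → Subset P
  U A z = ∀ a → a ∈ A → a ≤ z

  L : Subset P → Subset P
  L A z = ∀ a → a ∈ A → z ≤ a

  Min : Subset P → Subset P
  Min A z = (z ∈ A) × (∀ w → w ∈ A → w ≤ z → w ≡ z)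

  Max : Subset P → Subset P
  Max A z = (z ∈ A) × (∀ w → w ∈ A → z ≤ w → w ≡ z)

  MinU : Op P
  MinU A B = Min (U (A ∪ B))

  MaxL : Op P
  MaxL A B = Max (L (A ∪ B))

𝔸-⊔ : {P : Set} → (P → P → Set) → Op P
𝔸-⊔ _≤_ = MinU _≤_

𝔸-⊓ : {P : Set} → (P → P → Set) → Op P
𝔸-⊓ _≤_ = MaxL _≤_

ℙ-≤ : {P : Set} → Op P → P → P → Set
ℙ-≤ ⊔ x y = x ⟨ ⊔ ⟩ y ≐ ｛ y ｝

-- In (i) the order recovered from Min U is the original one because y is the least upper bound
-- of {x, y} exactly when x ≤ y.  In (ii), absorption (v) shows that u ⊔ z = z iff u ⊓ z = u,
-- so axiom (vi) literally says that x ⊔ y (x ⊓ y) is the set of minimal upper (maximal lower)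
-- bounds of {x, y} in ℙ(A).  Neither part uses the chain conditions, the bounds or finiteness.
module Submission where

open import Defs
open import Data.Product using (_×_; _,_; proj₁)
open import Data.Sum using (inj₁; inj₂)
open import Function.Bundles using (_⇔_; mk⇔; Equivalence)
open import Relation.Binary.PropositionalEquality using (_≡_; refl)
open import Relation.Binary.Structures using (IsPartialOrder)
open import Relation.Unary using (_∈_; _≐_; ｛_｝; _∪_)
open import Relation.Unary.Properties using (≐-refl; ≐-sym; ≐-trans)

module _ {P : Set} (_≤_ : P → P → Set) where

  U-pair : ∀ {x y z} → x ≤ z → y ≤ z → z ∈ U _≤_ (｛ x ｝ ∪ ｛ y ｝)
  U-pair x≤z y≤z _ (inj₁ refl) = x≤z
  U-pair x≤z y≤z _ (inj₂ refl) = y≤z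

  L-pair : ∀ {x y z} → z ≤ x → z ≤ y → z ∈ L _≤_ (｛ x ｝ ∪ ｛ y ｝)
  L-pair z≤x z≤y _ (inj₁ refl) = z≤x
  L-pair z≤x z≤y _ (inj₂ refl) = z≤y

module _ {P : Set} {_≤_ : P → P → Set} (po : IsPartialOrder _≡_ _≤_) where
  open IsPartialOrder po using (antisym) renaming (refl to ≤-refl)

  Min-least : ∀ {A : Subset P} {z} → z ∈ A → (∀ w → w ∈ A → z ≤ w) → Min _≤_ A ≐ ｛ z ｝
  Min-least {z = z} z∈A least =
      (λ { (w∈A , minimal) → minimal z z∈A (least _ w∈A) })
    , (λ { refl → z∈A , λ w w∈A w≤z → antisym w≤z (least w w∈A) })

  ≤⇔MinU≐ : ∀ x y → (x ≤ y) ⇔ (x ⟨ MinU _≤_ ⟩ y ≐ ｛ y ｝)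
  ≤⇔MinU≐ x y = mk⇔ to from
    where
    to : x ≤ y → x ⟨ MinU _≤_ ⟩ y ≐ ｛ y ｝
    to x≤y = Min-least (U-pair _≤_ x≤y ≤-refl) (λ w w∈U → w∈U y (inj₂ refl))

    from : x ⟨ MinU _≤_ ⟩ y ≐ ｛ y ｝ → x ≤ y
    from (_ , y∈MinU) = proj₁ (y∈MinU refl) x (inj₁ refl)

module OperatorStructure {P : Set} {⊔ ⊓ : Op P} {𝟘 𝟙 : P} (S : IsOperatorStructure ⊔ ⊓ 𝟘 𝟙) where
  open IsOperatorStructure S
  open Equivalence

  ℙ-≤⇔⊓≐ : ∀ u z → ℙ-≤ ⊔ u z ⇔ (u ⟨ ⊓ ⟩ z ≐ ｛ u ｝)
  ℙ-≤⇔⊓≐ u z = mk⇔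
    (λ u⊔z≐z → ≐-trans (⊓-cong ≐-refl (≐-sym u⊔z≐z)) (⊓-absorb u z))
    (λ u⊓z≐u → ≐-trans (⊔-cong (≐-sym u⊓z≐u) ≐-refl) (⊔-absorb u z))

  private
    ℙ⇒⊓ : ∀ {u z} → ℙ-≤ ⊔ u z → u ⟨ ⊓ ⟩ z ≐ ｛ u ｝
    ℙ⇒⊓ {u} {z} = to (ℙ-≤⇔⊓≐ u z)

    ⊓⇒ℙ : ∀ {u z} → u ⟨ ⊓ ⟩ z ≐ ｛ u ｝ → ℙ-≤ ⊔ u z
    ⊓⇒ℙ {u} {z} = from (ℙ-≤⇔⊓≐ u z)

  MinU-ℙ≐⊔ : ∀ x y → x ⟨ MinU (ℙ-≤ ⊔) ⟩ y ≐ x ⟨ ⊔ ⟩ y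
  MinU-ℙ≐⊔ x y =
      (λ { {z} (z∈U , minimal) → from (⊔-vi x y z)
             ( z∈U x (inj₁ refl) , z∈U y (inj₂ refl)
             , λ u x≤u y≤u u⊓z≐u → minimal u (U-pair (ℙ-≤ ⊔) x≤u y≤u) (⊓⇒ℙ u⊓z≐u)) })
    , (λ { {z} z∈x⊔y → let (x≤z , y≤z , minimal) = to (⊔-vi x y z) z∈x⊔y in
             U-pair (ℙ-≤ ⊔) x≤z y≤z
           , λ w w∈U w≤z → minimal w (w∈U x (inj₁ refl)) (w∈U y (inj₂ refl)) (ℙ⇒⊓ w≤z) })

  MaxL-ℙ≐⊓ : ∀ x y → x ⟨ MaxL (ℙ-≤ ⊔) ⟩ y ≐ x ⟨ ⊓ ⟩ y
  MaxL-ℙ≐⊓ x y =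
      (λ { {z} (z∈L , maximal) → from (⊓-vi x y z)
             ( ℙ⇒⊓ (z∈L x (inj₁ refl)) , ℙ⇒⊓ (z∈L y (inj₂ refl))
             , λ u u⊓x≐u u⊓y≐u z≤u → maximal u (L-pair (ℙ-≤ ⊔) (⊓⇒ℙ u⊓x≐u) (⊓⇒ℙ u⊓y≐u)) z≤u) })
    , (λ { {z} z∈x⊓y → let (z⊓x≐z , z⊓y≐z , maximal) = to (⊓-vi x y z) z∈x⊓y in
             L-pair (ℙ-≤ ⊔) (⊓⇒ℙ z⊓x≐z) (⊓⇒ℙ z⊓y≐z)
           , λ w w∈L z≤w → maximal w (ℙ⇒⊓ (w∈L x (inj₁ refl))) (ℙ⇒⊓ (w∈L y (inj₂ refl))) z≤w })

theorem3p4 :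
    ((P : Set) (_≤_ : P → P → Set) (𝟘 𝟙 : P) →
      IsBoundedPoset _≤_ 𝟘 𝟙 → ACC _≤_ → DCC _≤_ →
      ∀ x y → (x ≤ y) ⇔ ℙ-≤ (𝔸-⊔ _≤_) x y)
    ×
    ((P : Set) (⊔ ⊓ : Op P) (𝟘 𝟙 : P) →
      IsOperatorStructure ⊔ ⊓ 𝟘 𝟙 → Finite P →
      ∀ x y → (x ⟨ 𝔸-⊔ (ℙ-≤ ⊔) ⟩ y ≐ x ⟨ ⊔ ⟩ y) × (x ⟨ 𝔸-⊓ (ℙ-≤ ⊔) ⟩ y ≐ x ⟨ ⊓ ⟩ y))
theorem3p4 =
    (λ _ _ _ _ (po , _) _ _ → ≤⇔MinU≐ po)
  , (λ _ _ _ _ _ S _ x y → OperatorStructure.MinU-ℙ≐⊔ S x y , OperatorStructure.MaxL-ℙ≐⊓ S x y)
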